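{- Let $\mathbf{M}$ be an mm-logic and $\mathbf{Q}$ a pm-logic such that: (1) for every $\mathcal{L}_\exists$-formula $\varphi$, $\mathbf{M}\vdash\varphi$ implies $\mathbf{Q}\vdash\varphi^t$; (2) $\mathbf{M}$ is complete with respect to a class $\mathsf{C}$ of $\mathbf{MK}$-frames; (3) $\mathbf{Q}$ is strongly sound with respect to the class $\{\mathscr{B}(\mathfrak F)\mid\mathfrak F\in\mathsf C\}$. Then $\mathbf{M}$ is the monadic fragment of $\mathbf{Q}$, i.e., for every $\mathcal{L}_\exists$-formula $\varphi$, $\mathbf{M}\vdash\varphi$ iff $\mathbf{Q}\vdash\varphi^t$.
   Context: $\mathcal{L}_\exists$: propositional letters, $\neg,\vee$, modalities $\Diamond,\exists$. $\mathbf{MK}$ is the least set of $\mathcal{L}_\exists$-formulas containing the theorems of $\mathbf K$, the $\mathbf{S5}$ axioms for $\exists$, and $\exists\Diamond p\to\Diamond\exists p$, closed under modus ponens, $\Box$- and $\forall$-necessitation and substitution; an mm-logic is any set of $\mathcal{L}_\exists$-formulas containing $\mathbf{MK}$ closed under these rules. An $\mathbf{MK}$-frame is $(X,R,E)$, $X\ne\varnothing$, $R\subseteq X^2$, $E$ an equivalence relation, with $x\mathrel Ey$, $y\mathrel Rz$ implying $x\mathrel Ru$, $u\mathrel Ez$ for some $u$; $\Diamond$ is read via $R$, $\exists$ via $E$. $\mathcal{L}_Q$ is a first-order modal language (countably many variables and predicates, no function symbols or constants; connectives $\neg,\vee,\exists,\Diamond$). $\mathbf{QK}$ is the least set containing classical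 predicate axioms and theorems of $\mathbf K$, closed under modus ponens, necessitation, generalization and uniform substitution for predicates; a pm-logic is any set of $\mathcal{L}_Q$-formulas containing $\mathbf{QK}$ closed under these rules. The translation $(-)^t$ fixes a variable $x$, unary predicates $p^*$ for letters $p$, and sets $p^t=p^*(x)$, commutes with $\neg,\vee,\Diamond$, and $(\exists\varphi)^t=\exists x\varphi^t$. A Kripke bundle is $((X,R),\pi,(X_0,R_0))$ with $(X,R),(X_0,R_0)$ Kripke frames and $\pi$ a surjective p-morphism (i.e., $\pi(R[x])=R_0[\pi(x)]$). A valuation $I$ assigns to each $m$-ary predicate $P$ and $w\in X_0$ a set $I_w(P)\subseteq(\pi^{ -1}(w))^m$; at $w$ one evaluates sentences with constants from $\pi^{ -1}(w)$: $w\models P(\vec a)$ iff $\vec a\in I_w(P)$; Boolean clauses classical; $w\models\exists x\varphi$ iff $w\models\varphi[a/x]$ for some $a\in\pi^{ -1}(w)$; $w\models\Diamond\varphi[\vec a/\vec x]$ iff there are $v\in R_0[w]$ and $b_i\in R[a_i]\cap\pi^{ -1}(v)$, with $a_i=a_j\Rightarrow b_i=b_j$, such that $v\models\varphi[\vec b/\vec x]$. A formula is valid in the bundle if its universal closure holds at all worlds under all valuations; it is strongly valid if every substitution instance is valid; $\mathbf Q$ is strongly sound w.r.t. a class of bundles if all its formulas are strongly valid in each. For an $\mathbf{MK}$-frame $\mathfrak F=(X,R,E)$, $\mathscr B(\mathfrak F)=((X,R),\pi,(X/E,R_0))$ where $\pi$ is the quotient map and $[x]\mathrel{R_0}[y]$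 iff there is $z$ with $x\mathrel Rz$ and $z\mathrel Ey$. -}

module Defs where

open import Data.Nat using (ℕ; zero; suc; _≡ᵇ_)
open import Data.Bool using (Bool; true; false; if_then_else_; not; _∧_; _∨_; T)
open import Data.List using (List; []; _∷_)
open import Data.Bool.ListAction using (any; all)
open import Data.Vec using (Vec; []; _∷_; toList)
import Data.Vec as Vec
open import Data.Vec.Relation.Unary.All using (All)
open import Data.Product using (Σ; _×_; _,_)
open import Relation.Nullary using (¬_)
open import Relation.Binary.PropositionalEquality using (_≡_)
open import Relation.Binary.Structures using (IsEquivalence)

-- classical (double-negation) reading of existence / disjunction
¬¬_ : Set → Set
¬¬ A = ¬ ¬ A

elemᵇ : ℕ → List ℕ → Bool
elemᵇ k = any (λ m → k ≡ᵇ m)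

_[_↦_] : {A : Set} → (ℕ → A) → ℕ → A → (ℕ → A)
(ρ [ x ↦ a ]) k = if k ≡ᵇ x then a else ρ k

data FormE : Set where
  varE : ℕ → FormE
  negE : FormE → FormE
  orE  : FormE → FormE → FormE
  diaE : FormE → FormE
  exE  : FormE → FormE

_⇒E_ : FormE → FormE → FormE
φ ⇒E ψ = orE (negE φ) ψ

_∧E_ : FormE → FormE → FormE
φ ∧E ψ = negE (orE (negE φ) (negE ψ))

boxE : FormE → FormE
boxE φ = negE (diaE (negE φ))

allE : FormE → FormE
allE φ = negE (exE (negE φ))

substE : (ℕ → FormE) → FormE → FormE
substE σ (varE p)   = σ p
substE σ (negE φ)   = negE (substE σ φ)
substE σ (orE φ ψ)  = orE (substE σ φ) (substE σ ψ)
substE σ (diaE φ)   = diaE (substE σ φ)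
substE σ (exE φ)    = exE (substE σ φ)

-- Theorems of K (in the language L∃; ∃-formulas behave as atoms).
-- Hilbert–Ackermann axioms for classical logic in ¬,∨ (with → := ¬φ∨ψ),
-- the K axiom and the duality axioms for ◇ / □ := ¬◇¬; rules MP, □-necessitation.
data KThm : FormE → Set where
  K-ha1  : ∀ φ → KThm (orE φ φ ⇒E φ)
  K-ha2  : ∀ φ ψ → KThm (φ ⇒E orE φ ψ)
  K-ha3  : ∀ φ ψ → KThm (orE φ ψ ⇒E orE ψ φ)
  K-ha4  : ∀ φ ψ χ → KThm ((ψ ⇒E χ) ⇒E (orE φ ψ ⇒E orE φ χ))
  K-kax  : ∀ φ ψ → KThm (boxE (φ ⇒E ψ) ⇒E (boxE φ ⇒E boxE ψ))
  K-dual₁ : ∀ φ → KThm (diaE φ ⇒E negE (boxE (negE φ)))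
  K-dual₂ : ∀ φ → KThm (negE (boxE (negE φ)) ⇒E diaE φ)
  K-mp   : ∀ {φ ψ} → KThm φ → KThm (φ ⇒E ψ) → KThm ψ
  K-nec  : ∀ {φ} → KThm φ → KThm (boxE φ)

data MK : FormE → Set where
  MK-kthm  : ∀ {φ} → KThm φ → MK φ
  MK-e-k   : ∀ φ ψ → MK (allE (φ ⇒E ψ) ⇒E (allE φ ⇒E allE ψ))
  MK-e-dual₁ : ∀ φ → MK (exE φ ⇒E negE (allE (negE φ)))
  MK-e-dual₂ : ∀ φ → MK (negE (allE (negE φ)) ⇒E exE φ)
  MK-e-t   : ∀ φ → MK (φ ⇒E exE φ)
  MK-e-4   : ∀ φ → MK (exE (exE φ) ⇒E exE φ)
  MK-e-b   : ∀ φ → MK (φ ⇒E allE (exE φ))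
  MK-comm  : MK (exE (diaE (varE 0)) ⇒E diaE (exE (varE 0)))
  MK-mp    : ∀ {φ ψ} → MK φ → MK (φ ⇒E ψ) → MK ψ
  MK-nec□  : ∀ {φ} → MK φ → MK (boxE φ)
  MK-nec∀  : ∀ {φ} → MK φ → MK (allE φ)
  MK-sub   : ∀ {φ} (σ : ℕ → FormE) → MK φ → MK (substE σ φ)

record MMLogic (M : FormE → Set) : Set where
  field
    ⊇MK  : ∀ {φ} → MK φ → M φ
    mp   : ∀ {φ ψ} → M φ → M (φ ⇒E ψ) → M ψ
    nec□ : ∀ {φ} → M φ → M (boxE φ)
    nec∀ : ∀ {φ} → M φ → M (allE φ)
    sub  : ∀ {φ} (σ : ℕ → FormE) → M φ → M (substE σ φ)

record MKFrame : Set₁ where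
  field
    X     : Set
    R     : X → X → Set
    E     : X → X → Set
    point : X
    E-equiv : IsEquivalence E
    mk-cond : ∀ {x y z} → E x y → R y z → Σ X (λ u → R x u × E u z)

module _ (F : MKFrame) where
  open MKFrame F
  satF : (ℕ → X → Set) → X → FormE → Set
  satF V x (varE p)  = ¬¬ V p x
  satF V x (negE φ)  = ¬ satF V x φ
  satF V x (orE φ ψ) = ¬ (¬ satF V x φ × ¬ satF V x ψ)
  satF V x (diaE φ)  = ¬¬ Σ X (λ y → R x y × satF V y φ)
  satF V x (exE φ)   = ¬¬ Σ X (λ y → E x y × satF V y φ)

  ValidF : FormE → Set₁
  ValidF φ = (V : ℕ → X → Set) (x : X) → satF V x φ

CompleteWrt : (FormE → Set) → (MKFrame → Set) → Set₁
CompleteWrt M C = ∀ φ → (∀ F → C F → ValidF F φ) → M φ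

-- The first-order modal language L_Q (named variables ℕ; predicate
-- letters P^n_i of arity n, index i; connectives ¬, ∨, ∃, ◇)

data FormQ : Set where
  atQ  : (n i : ℕ) → Vec ℕ n → FormQ
  negQ : FormQ → FormQ
  orQ  : FormQ → FormQ → FormQ
  diaQ : FormQ → FormQ
  exQ  : ℕ → FormQ → FormQ

_⇒Q_ : FormQ → FormQ → FormQ
φ ⇒Q ψ = orQ (negQ φ) ψ

boxQ : FormQ → FormQ
boxQ φ = negQ (diaQ (negQ φ))

allQ : ℕ → FormQ → FormQ
allQ x φ = negQ (exQ x (negQ φ))

isFree : ℕ → FormQ → Bool
isFree k (atQ n i zs) = elemᵇ k (toList zs)
isFree k (negQ φ)     = isFree k φ
isFree k (orQ φ ψ)    = isFree k φ ∨ isFree k ψ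
isFree k (diaQ φ)     = isFree k φ
isFree k (exQ x φ)    = not (k ≡ᵇ x) ∧ isFree k φ

-- renaming of free variables by σ; B = variables bound so far (inside)
renB : (ℕ → ℕ) → List ℕ → FormQ → FormQ
renB σ B (atQ n i zs) = atQ n i (Vec.map (λ z → if elemᵇ z B then z else σ z) zs)
renB σ B (negQ φ)     = negQ (renB σ B φ)
renB σ B (orQ φ ψ)    = orQ (renB σ B φ) (renB σ B ψ)
renB σ B (diaQ φ)     = diaQ (renB σ B φ)
renB σ B (exQ x φ)    = exQ x (renB σ (x ∷ B) φ)

ren : (ℕ → ℕ) → FormQ → FormQ
ren σ = renB σ []

-- no capture: the image of every free occurrence is not bound at that place
renOKB : (ℕ → ℕ) → List ℕ → FormQ → Bool
renOKB σ B (atQ n i zs) = all (λ z → elemᵇ z B ∨ not (elemᵇ (σ z) B)) (toList zs)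
renOKB σ B (negQ φ)     = renOKB σ B φ
renOKB σ B (orQ φ ψ)    = renOKB σ B φ ∧ renOKB σ B ψ
renOKB σ B (diaQ φ)     = renOKB σ B φ
renOKB σ B (exQ x φ)    = renOKB σ (x ∷ B) φ

renOK : (ℕ → ℕ) → FormQ → Bool
renOK σ = renOKB σ []

idℕ : ℕ → ℕ
idℕ k = k

substVar : ℕ → ℕ → FormQ → FormQ
substVar y x = ren (idℕ [ x ↦ y ])

freeFor : ℕ → ℕ → FormQ → Bool
freeFor y x = renOK (idℕ [ x ↦ y ])

-- Uniform substitution for predicates: P^n_i(y₁..yₙ) ↦ ψ, where ψ may
-- contain parameters (free variables other than y₁..yₙ).
record PSubEntry (n : ℕ) : Set where
  constructor _/_
  field
    body : FormQ
    args : Vec ℕ n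

PSub : Set
PSub = (n i : ℕ) → PSubEntry n

tmpl : ∀ {n} → Vec ℕ n → Vec ℕ n → ℕ → ℕ
tmpl []       []       k = k
tmpl (y ∷ ys) (z ∷ zs) k = if k ≡ᵇ y then z else tmpl ys zs k

applyPS : PSub → FormQ → FormQ
applyPS S (atQ n i zs) = ren (tmpl (PSubEntry.args (S n i)) zs) (PSubEntry.body (S n i))
applyPS S (negQ φ)     = negQ (applyPS S φ)
applyPS S (orQ φ ψ)    = orQ (applyPS S φ) (applyPS S ψ)
applyPS S (diaQ φ)     = diaQ (applyPS S φ)
applyPS S (exQ x φ)    = exQ x (applyPS S φ)

-- admissibility (no variable capture); B = variables bound around the occurrence
PSOKB : PSub → List ℕ → FormQ → Set
PSOKB S B (atQ n i zs) =
  T (renOK (tmpl (PSubEntry.args (S n i)) zs) (PSubEntry.body (S n i)))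
  × (∀ k → T (isFree k (PSubEntry.body (S n i)))
         → T (not (elemᵇ k (toList (PSubEntry.args (S n i)))))
         → T (not (elemᵇ k B)))
PSOKB S B (negQ φ)  = PSOKB S B φ
PSOKB S B (orQ φ ψ) = PSOKB S B φ × PSOKB S B ψ
PSOKB S B (diaQ φ)  = PSOKB S B φ
PSOKB S B (exQ x φ) = PSOKB S (x ∷ B) φ

PSOK : PSub → FormQ → Set
PSOK S = PSOKB S []

-- QK: classical predicate axioms (Hilbert–Ackermann + Mendelson's
-- quantifier axioms, ∀ := ¬∃¬ with duality), theorems of K,
-- closed under MP, necessitation, generalization, predicate substitution.
data QK : FormQ → Set where
  QK-ha1  : ∀ φ → QK (orQ φ φ ⇒Q φ)
  QK-ha2  : ∀ φ ψ → QK (φ ⇒Q orQ φ ψ)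
  QK-ha3  : ∀ φ ψ → QK (orQ φ ψ ⇒Q orQ ψ φ)
  QK-ha4  : ∀ φ ψ χ → QK ((ψ ⇒Q χ) ⇒Q (orQ φ ψ ⇒Q orQ φ χ))
  QK-q-inst : ∀ x y φ → T (freeFor y x φ) → QK (allQ x φ ⇒Q substVar y x φ)
  QK-q-dist : ∀ x φ ψ → T (not (isFree x φ)) → QK (allQ x (φ ⇒Q ψ) ⇒Q (φ ⇒Q allQ x ψ))
  QK-q-dual₁ : ∀ x φ → QK (exQ x φ ⇒Q negQ (allQ x (negQ φ)))
  QK-q-dual₂ : ∀ x φ → QK (negQ (allQ x (negQ φ)) ⇒Q exQ x φ)
  QK-kax  : ∀ φ ψ → QK (boxQ (φ ⇒Q ψ) ⇒Q (boxQ φ ⇒Q boxQ ψ))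
  QK-dual₁ : ∀ φ → QK (diaQ φ ⇒Q negQ (boxQ (negQ φ)))
  QK-dual₂ : ∀ φ → QK (negQ (boxQ (negQ φ)) ⇒Q diaQ φ)
  QK-mp   : ∀ {φ ψ} → QK φ → QK (φ ⇒Q ψ) → QK ψ
  QK-nec  : ∀ {φ} → QK φ → QK (boxQ φ)
  QK-gen  : ∀ {φ} x → QK φ → QK (allQ x φ)
  QK-psub : ∀ {φ} (S : PSub) → PSOK S φ → QK φ → QK (applyPS S φ)

record PMLogic (Q : FormQ → Set) : Set where
  field
    ⊇QK  : ∀ {φ} → QK φ → Q φ
    mp   : ∀ {φ ψ} → Q φ → Q (φ ⇒Q ψ) → Q ψ
    nec  : ∀ {φ} → Q φ → Q (boxQ φ)
    gen  : ∀ {φ} x → Q φ → Q (allQ x φ)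
    psub : ∀ {φ} (S : PSub) → PSOK S φ → Q φ → Q (applyPS S φ)

-- The translation (-)^t, with x := variable 0 and p* := P^1_p

tr : FormE → FormQ
tr (varE p)  = atQ 1 p (0 ∷ [])
tr (negE φ)  = negQ (tr φ)
tr (orE φ ψ) = orQ (tr φ) (tr ψ)
tr (diaE φ)  = diaQ (tr φ)
tr (exE φ)   = exQ 0 (tr φ)

-- Kripke bundles.  The base set is given as a setoid (X₀, ≈₀), since
-- quotients are not available; everything on the base respects ≈₀.

record KBundle : Set₁ where
  field
    X     : Set
    R     : X → X → Set
    point : X
    X₀    : Set
    _≈₀_  : X₀ → X₀ → Set
    ≈₀-equiv : IsEquivalence _≈₀_
    R₀    : X₀ → X₀ → Set
    R₀-resp : ∀ {w w' v v'} → w ≈₀ w' → v ≈₀ v' → R₀ w v → R₀ w' v'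
    π     : X → X₀
    π-surj  : ∀ w → Σ X (λ a → π a ≈₀ w)
    -- π(R[a]) = R₀[π a]
    π-forth : ∀ {a b} → R a b → R₀ (π a) (π b)
    π-back  : ∀ {a w} → R₀ (π a) w → Σ X (λ b → R a b × π b ≈₀ w)

module _ (B : KBundle) where
  open KBundle B

  record Valuation : Set₁ where
    field
      I     : X₀ → (n i : ℕ) → Vec X n → Set
      I-fib : ∀ {w n i as} → I w n i as → All (λ a → π a ≈₀ w) as
      I-resp : ∀ {w w' n i as} → w ≈₀ w' → I w n i as → I w' n i as

  -- satisfaction at w of φ with its free variables interpreted by ρ
  -- (i.e. of the sentence φ[ρ] with constants from the fibre over w)
  satB : Valuation → X₀ → (ℕ → X) → FormQ → Set
  satB V w ρ (atQ n i zs) = ¬¬ Valuation.I V w n i (Vec.map ρ zs)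
  satB V w ρ (negQ φ)     = ¬ satB V w ρ φ
  satB V w ρ (orQ φ ψ)    = ¬ (¬ satB V w ρ φ × ¬ satB V w ρ ψ)
  satB V w ρ (exQ x φ)    = ¬¬ Σ X (λ a → π a ≈₀ w × satB V w (ρ [ x ↦ a ]) φ)
  satB V w ρ (diaQ φ)     = ¬¬ Σ X₀ (λ v → R₀ w v × Σ (ℕ → X) (λ σ →
       (∀ k → π (σ k) ≈₀ v)
     × (∀ k → T (isFree k φ) → R (ρ k) (σ k))
     × (∀ k l → T (isFree k φ) → T (isFree l φ) → ρ k ≡ ρ l → σ k ≡ σ l)
     × satB V v σ φ))

  -- validity: the universal closure holds at every world under every valuation
  ValidB : FormQ → Set₁
  ValidB φ = (V : Valuation) (w : X₀) (ρ : ℕ → X) → (∀ k → π (ρ k) ≈₀ w) → satB V w ρ φ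

  StronglyValidB : FormQ → Set₁
  StronglyValidB φ = (S : PSub) → PSOK S φ → ValidB (applyPS S φ)

StronglySound : (FormQ → Set) → KBundle → Set₁
StronglySound Q B = ∀ φ → Q φ → StronglyValidB B φ

-- The bundle 𝓑(𝔉) of an MK-frame: base X/E rendered as the setoid (X, E),
-- π the quotient map (identity on representatives),
-- [x] R₀ [y] iff ∃ z. x R z ∧ z E y.

𝓑 : MKFrame → KBundle
𝓑 F = record
  { X = X ; R = R ; point = point
  ; X₀ = X ; _≈₀_ = E ; ≈₀-equiv = E-equiv
  ; R₀ = λ x y → Σ X (λ z → R x z × E z y)
  ; R₀-resp = λ {w} {w'} {v} {v'} ww' vv' r → resp ww' vv' r
  ; π = λ x → x
  ; π-surj = λ w → w , IsEquivalence.refl E-equiv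
  ; π-forth = λ {a} {b} r → b , r , IsEquivalence.refl E-equiv
  ; π-back = λ r → r
  }
  where
  open MKFrame F
  resp : ∀ {w w' v v'} → E w w' → E v v' → Σ X (λ z → R w z × E z v) → Σ X (λ z → R w' z × E z v')
  resp ww' vv' (z , rz , zv) with mk-cond (IsEquivalence.sym E-equiv ww') rz
  ... | u , ru , uz = u , ru , IsEquivalence.trans E-equiv uz (IsEquivalence.trans E-equiv zv vv')

{-# OPTIONS --safe #-}
-- If Q ⊢ φᵗ, then φᵗ is strongly valid, hence (substituting each predicate by itself) valid,
-- in 𝓑(𝔉) for every 𝔉 ∈ C.  A valuation V on 𝔉 induces one on 𝓑(𝔉) interpreting p* on the
-- fibre over [y] as V(p) ∩ [y]; by induction on φ, φᵗ holds at [w] with the variable x assigned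
-- to some y ∈ [w] iff φ holds at y in 𝔉.  So φ is valid on C, and M ⊢ φ by completeness.
module Submission where

open import Defs
open import Function.Bundles using (_⇔_; mk⇔; Equivalence)
open import Function.Base using (const; _∘_)
open import Data.Nat using (ℕ; zero; suc; _≡ᵇ_; z≤n; s≤s)
import Data.Nat.Properties as ℕ
open import Data.Bool using (if_then_else_; T; T?)
open import Data.Bool.Properties using (T-∨; T-∧; T-not-≡)
open import Data.Unit using (tt)
open import Data.Empty using (⊥; ⊥-elim)
open import Data.Sum using ([_,_]; inj₁; inj₂)
open import Data.Product using (_×_; _,_; proj₁; proj₂)
open import Data.List using ([]; _∷_)
open import Data.List.Relation.Unary.All using (universal)
open import Data.List.Relation.Unary.All.Properties using (all⁻)
open import Data.Fin as Fin using (Fin; toℕ)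
open import Data.Vec using (Vec; []; _∷_; tabulate; lookup)
import Data.Vec as Vec
open import Data.Vec.Properties using (tabulate-∘; tabulate-cong; tabulate∘lookup; lookup∘tabulate)
open import Data.Vec.Relation.Unary.All using (All; []; _∷_)
import Data.Vec.Relation.Unary.All as All
open import Relation.Nullary using (¬_; yes; no)
open import Relation.Nullary.Negation using (¬¬-map)
open import Relation.Binary.PropositionalEquality
  using (_≡_; _≢_; refl; sym; trans; cong; cong₂; subst; module ≡-Reasoning)
open import Relation.Binary.Structures using (IsEquivalence)

if-≡ᵇ-refl : ∀ {A : Set} y {a b : A} → (if y ≡ᵇ y then a else b) ≡ a
if-≡ᵇ-refl zero    = refl
if-≡ᵇ-refl (suc y) = if-≡ᵇ-refl y

if-≡ᵇ-≢ : ∀ {A : Set} k y {a b : A} → k ≢ y → (if k ≡ᵇ y then a else b) ≡ b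
if-≡ᵇ-≢ zero    zero    k≢y = ⊥-elim (k≢y refl)
if-≡ᵇ-≢ zero    (suc y) k≢y = refl
if-≡ᵇ-≢ (suc k) zero    k≢y = refl
if-≡ᵇ-≢ (suc k) (suc y) k≢y = if-≡ᵇ-≢ k y (k≢y ∘ cong suc)

tmpl-lookup : ∀ {n} (ys zs : Vec ℕ n) (i : Fin n)
            → (∀ j → j Fin.< i → lookup ys j ≢ lookup ys i)
            → tmpl ys zs (lookup ys i) ≡ lookup zs i
tmpl-lookup (y ∷ ys) (z ∷ zs) Fin.zero    _        = if-≡ᵇ-refl y
tmpl-lookup (y ∷ ys) (z ∷ zs) (Fin.suc i) distinct = begin
  (if lookup ys i ≡ᵇ y then z else tmpl ys zs (lookup ys i))
    ≡⟨ if-≡ᵇ-≢ (lookup ys i) y (distinct Fin.zero (s≤s z≤n) ∘ sym) ⟩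
  tmpl ys zs (lookup ys i)
    ≡⟨ tmpl-lookup ys zs i (λ j j<i → distinct (Fin.suc j) (s≤s j<i)) ⟩
  lookup zs i ∎
  where open ≡-Reasoning

upTo : (n : ℕ) → Vec ℕ n
upTo n = tabulate toℕ

tmpl-upTo : ∀ {n} (zs : Vec ℕ n) (i : Fin n) → tmpl (upTo n) zs (toℕ i) ≡ lookup zs i
tmpl-upTo zs i = begin
  tmpl (upTo _) zs (toℕ i)               ≡⟨ cong (tmpl (upTo _) zs) (sym (lookup-upTo i)) ⟩
  tmpl (upTo _) zs (lookup (upTo _) i)   ≡⟨ tmpl-lookup (upTo _) zs i distinct ⟩
  lookup zs i                            ∎
  where
  open ≡-Reasoning
  lookup-upTo : ∀ {n} (j : Fin n) → lookup (upTo n) j ≡ toℕ j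
  lookup-upTo = lookup∘tabulate toℕ
  distinct : ∀ j → j Fin.< i → lookup (upTo _) j ≢ lookup (upTo _) i
  distinct j j<i eq = ℕ.<⇒≢ j<i (trans (sym (lookup-upTo j)) (trans eq (lookup-upTo i)))

map-tmpl-upTo : ∀ {n} (zs : Vec ℕ n) → Vec.map (tmpl (upTo n) zs) (upTo n) ≡ zs
map-tmpl-upTo zs = begin
  Vec.map (tmpl (upTo _) zs) (tabulate toℕ) ≡⟨ sym (tabulate-∘ (tmpl (upTo _) zs) toℕ) ⟩
  tabulate (tmpl (upTo _) zs ∘ toℕ)         ≡⟨ tabulate-cong (tmpl-upTo zs) ⟩
  tabulate (lookup zs)                      ≡⟨ tabulate∘lookup zs ⟩
  zs                                        ∎
  where open ≡-Reasoning

idPSub : PSub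
idPSub n i = atQ n i (upTo n) / upTo n

applyPS-idPSub : ∀ φ → applyPS idPSub φ ≡ φ
applyPS-idPSub (atQ n i zs) = cong (atQ n i) (map-tmpl-upTo zs)
applyPS-idPSub (negQ φ)     = cong negQ (applyPS-idPSub φ)
applyPS-idPSub (orQ φ ψ)    = cong₂ orQ (applyPS-idPSub φ) (applyPS-idPSub ψ)
applyPS-idPSub (diaQ φ)     = cong diaQ (applyPS-idPSub φ)
applyPS-idPSub (exQ x φ)    = cong (exQ x) (applyPS-idPSub φ)

PSOKB-idPSub : ∀ B φ → PSOKB idPSub B φ
PSOKB-idPSub B (atQ n i zs) =
  all⁻ _ (universal (λ _ → tt) (Vec.toList (upTo n))) ,
  λ k free notFree → ⊥-elim (subst T (Equivalence.to T-not-≡ notFree) free)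
PSOKB-idPSub B (negQ φ)     = PSOKB-idPSub B φ
PSOKB-idPSub B (orQ φ ψ)    = PSOKB-idPSub B φ , PSOKB-idPSub B ψ
PSOKB-idPSub B (diaQ φ)     = PSOKB-idPSub B φ
PSOKB-idPSub B (exQ x φ)    = PSOKB-idPSub (x ∷ B) φ

stronglyValid⇒valid : ∀ (𝔅 : KBundle) φ → StronglyValidB 𝔅 φ → ValidB 𝔅 φ
stronglyValid⇒valid 𝔅 φ strong =
  subst (ValidB 𝔅) (applyPS-idPSub φ) (strong idPSub (PSOKB-idPSub [] φ))

isFree-tr⇒≡0 : ∀ φ {k} → T (isFree k (tr φ)) → k ≡ 0
isFree-tr⇒≡0 (varE p) {zero}  _  = refl
isFree-tr⇒≡0 (varE p) {suc k} ()
isFree-tr⇒≡0 (negE φ)        = isFree-tr⇒≡0 φ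
isFree-tr⇒≡0 (orE φ ψ)       = [ isFree-tr⇒≡0 φ , isFree-tr⇒≡0 ψ ] ∘ Equivalence.to T-∨
isFree-tr⇒≡0 (diaE φ)        = isFree-tr⇒≡0 φ
isFree-tr⇒≡0 (exE φ)         = isFree-tr⇒≡0 φ ∘ proj₂ ∘ Equivalence.to T-∧

module _ (F : MKFrame) where
  open MKFrame F
  open IsEquivalence E-equiv renaming (refl to E-refl; sym to E-sym; trans to E-trans)

  liftValuation : (ℕ → X → Set) → Valuation (𝓑 F)
  liftValuation V = record
    { I      = λ w n i as → All (λ a → E a w) as × letter n i as
    ; I-fib  = proj₁
    ; I-resp = λ w≈w' (as∈w , sat) → All.map (λ aEw → E-trans aEw w≈w') as∈w , sat
    }
    where
    letter : (n i : ℕ) → Vec X n → Set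
    letter 1 p (a ∷ []) = V p a
    letter _ _ _        = ⊥

  module _ (V : ℕ → X → Set) where

    -- If φᵗ has no free x, every occurrence of a letter in φ lies under ∃.
    satF-resp-E : ∀ φ → ¬ T (isFree 0 (tr φ))
                → ∀ {x y} → E x y → satF F V x φ → satF F V y φ
    satF-resp-E (varE p)  notFree = ⊥-elim (notFree tt)
    satF-resp-E (negE φ)  notFree xEy ¬sat sat = ¬sat (satF-resp-E φ notFree (E-sym xEy) sat)
    satF-resp-E (orE φ ψ) notFree xEy sat (¬φ , ¬ψ) = sat
      ( ¬φ ∘ satF-resp-E φ (notFree ∘ Equivalence.from T-∨ ∘ inj₁) xEy
      , ¬ψ ∘ satF-resp-E ψ (notFree ∘ Equivalence.from T-∨ ∘ inj₂) xEy )
    satF-resp-E (diaE φ)  notFree xEy = ¬¬-map λ { (z , xRz , sat) →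
      let (u , yRu , uEz) = mk-cond (E-sym xEy) xRz
      in u , yRu , satF-resp-E φ notFree (E-sym uEz) sat }
    satF-resp-E (exE φ)   notFree xEy = ¬¬-map λ { (z , xEz , sat) →
      z , E-trans (E-sym xEy) xEz , sat }

    satB-tr⇒satF : ∀ φ {w ρ} → E (ρ 0) w
                 → satB (𝓑 F) (liftValuation V) w ρ (tr φ) → satF F V (ρ 0) φ
    satF⇒satB-tr : ∀ φ {w ρ} → E (ρ 0) w
                 → satF F V (ρ 0) φ → satB (𝓑 F) (liftValuation V) w ρ (tr φ)

    satB-tr⇒satF (varE p)  _  = ¬¬-map proj₂
    satB-tr⇒satF (negE φ)  ρ0Ew ¬sat = ¬sat ∘ satF⇒satB-tr φ ρ0Ew
    satB-tr⇒satF (orE φ ψ) ρ0Ew sat (¬φ , ¬ψ) =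
      sat (¬φ ∘ satB-tr⇒satF φ ρ0Ew , ¬ψ ∘ satB-tr⇒satF ψ ρ0Ew)
    satB-tr⇒satF (exE φ)   ρ0Ew = ¬¬-map λ { (a , aEw , sat) →
      a , E-trans ρ0Ew (E-sym aEw) , satB-tr⇒satF φ aEw sat }
    satB-tr⇒satF (diaE φ)  ρ0Ew with T? (isFree 0 (tr φ))
    ... | yes free = ¬¬-map λ { (v , _ , σ , σ∈v , ρRσ , _ , sat) →
      σ 0 , ρRσ 0 free , satB-tr⇒satF φ (σ∈v 0) sat }
    -- With x not free in φᵗ, σ 0 need not be an R-successor of ρ 0; the MK condition yields one, u,
    -- E-equivalent to σ 0, and truth transfers by satF-resp-E.
    ... | no notFree = ¬¬-map λ { (v , (z , wRz , zEv) , σ , σ∈v , _ , _ , sat) →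
      let (u , ρ0Ru , uEz) = mk-cond ρ0Ew wRz
      in u , ρ0Ru , satF-resp-E φ notFree (E-trans (σ∈v 0) (E-sym (E-trans uEz zEv)))
                                          (satB-tr⇒satF φ (σ∈v 0) sat) }

    satF⇒satB-tr (varE p)  ρ0Ew = ¬¬-map (ρ0Ew ∷ [] ,_)
    satF⇒satB-tr (negE φ)  ρ0Ew ¬sat = ¬sat ∘ satB-tr⇒satF φ ρ0Ew
    satF⇒satB-tr (orE φ ψ) ρ0Ew sat (¬φ , ¬ψ) =
      sat (¬φ ∘ satF⇒satB-tr φ ρ0Ew , ¬ψ ∘ satF⇒satB-tr ψ ρ0Ew)
    satF⇒satB-tr (exE φ)   ρ0Ew = ¬¬-map λ { (y , ρ0Ey , sat) →
      y , E-trans (E-sym ρ0Ey) ρ0Ew , satF⇒satB-tr φ (E-trans (E-sym ρ0Ey) ρ0Ew) sat }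
    satF⇒satB-tr (diaE φ) {ρ = ρ} ρ0Ew = ¬¬-map λ { (y , ρ0Ry , sat) →
      y , mk-cond (E-sym ρ0Ew) ρ0Ry , const y , const E-refl
        , (λ k free → subst (λ m → R (ρ m) y) (sym (isFree-tr⇒≡0 φ free)) ρ0Ry)
        , (λ _ _ _ _ _ → refl) , satF⇒satB-tr φ E-refl sat }

  validB-tr⇒validF : ∀ φ → ValidB (𝓑 F) (tr φ) → ValidF F φ
  validB-tr⇒validF φ valid V x =
    satB-tr⇒satF V φ E-refl (valid (liftValuation V) x (const x) (const E-refl))

theorem5p4 : (M : FormE → Set) (Q : FormQ → Set)
           → MMLogic M → PMLogic Q
           → (∀ φ → M φ → Q (tr φ))
           → (C : MKFrame → Set)
           → CompleteWrt M C
           → (∀ F → C F → StronglySound Q (𝓑 F))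
           → ∀ φ → M φ ⇔ Q (tr φ)
theorem5p4 M Q _ _ M⊢⇒Q⊢tr C complete sound φ = mk⇔ (M⊢⇒Q⊢tr φ) λ Q⊢φᵗ →
  complete φ λ F F∈C →
    validB-tr⇒validF F φ (stronglyValid⇒valid (𝓑 F) (tr φ) (sound F F∈C (tr φ) Q⊢φᵗ))
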